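{- Let $\mathcal A$ be any collection of permutations from $S_n$. Then for any $i,j\in[n]$ with $i<j$, $|\mathcal C_{i,j}(\mathcal A)| = |\mathcal A|$.
   Context: $S_n$ is the symmetric group on $[n]=\{1,\dots,n\}$. For $\sigma\in S_n$ and $i<j$ in $[n]$, the $(i,j)$-compression $\sigma_{i,j}$ is defined by: if $\sigma(i)=i$ or $\sigma(j)\neq j$ then $\sigma_{i,j}=\sigma$; if $\sigma(i)\neq i$ and $\sigma(j)=j$ then $\sigma_{i,j}(i)=i$, $\sigma_{i,j}(j)=\sigma(i)$, $\sigma_{i,j}(\sigma^{ -1}(i))=j$, and $\sigma_{i,j}(y)=\sigma(y)$ for all other $y$. For a family $\mathcal A\subseteq S_n$, $\mathcal C_{i,j}(\mathcal A)=\{\mathcal C_{i,j}(\sigma):\sigma\in\mathcal A\}$ where $\mathcal C_{i,j}(\sigma)=\sigma_{i,j}$ if $\sigma_{i,j}\notin\mathcal A$ and $\mathcal C_{i,j}(\sigma)=\sigma$ otherwise. -}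

module Defs where

open import Data.Nat using (ℕ)
open import Data.Fin using (Fin; _≟_)
open import Data.Vec using (Vec; lookup; tabulate; toList)
open import Data.Vec.Properties using (≡-dec)
open import Data.List using (List; map)
open import Data.List.Relation.Unary.Unique.Propositional using (Unique)
open import Data.List.Relation.Unary.All using (All)
import Data.List.Membership.DecPropositional as DecMem
open import Relation.Binary.Definitions using (DecidableEquality)
import Data.List
open import Relation.Nullary using (yes; no)
open import Relation.Binary.PropositionalEquality using (_≡_)

_≟ᵥ_ : {n : ℕ} → DecidableEquality (Vec (Fin n) n)
_≟ᵥ_ = ≡-dec _≟_

-- [n] is modelled by Fin n.  A permutation of [n] is represented by its
-- table of values σ = (σ(0), …, σ(n-1)) : Vec (Fin n) n, which is a
-- permutation iff its entries are pairwise distinct.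
IsPerm : {n : ℕ} → Vec (Fin n) n → Set
IsPerm σ = Unique (toList σ)

compress : {n : ℕ} → Fin n → Fin n → Vec (Fin n) n → Vec (Fin n) n
compress i j σ with lookup σ i ≟ i | lookup σ j ≟ j
... | yes _ | _     = σ
... | no _  | no _  = σ
... | no _  | yes _ = tabulate f
  where
  f : _ → _
  f y with y ≟ i | y ≟ j | lookup σ y ≟ i
  ... | yes _ | _     | _     = i
  ... | no _  | yes _ | _     = lookup σ i
  ... | no _  | no _  | yes _ = j
  ... | no _  | no _  | no _  = lookup σ y

compressIn : {n : ℕ} → Fin n → Fin n → List (Vec (Fin n) n) → Vec (Fin n) n → Vec (Fin n) n
compressIn i j A σ with DecMem._∈?_ _≟ᵥ_ (compress i j σ) A
... | yes _ = σ
... | no _  = compress i j σ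

-- C_{i,j}(A) = { C_{i,j}(σ) : σ ∈ A }, as a list (possibly with repetitions)
compressFamily : {n : ℕ} → Fin n → Fin n → List (Vec (Fin n) n) → List (Vec (Fin n) n)
compressFamily i j A = map (compressIn i j A) A

card : {n : ℕ} → List (Vec (Fin n) n) → ℕ
card xs = Data.List.length (Data.List.deduplicate _≟ᵥ_ xs)

module Submission where

-- Since C_{i,j}(A) is the image of A under σ ↦ C_{i,j}(σ), it suffices to show
-- that this map is injective on A, because the image of a list under a map
-- that is injective on it has as many distinct elements as the list itself.
-- The only nontrivial case of injectivity is two members σ, τ of A that are
-- both genuinely compressed (σ(i) ≠ i, σ(j) = j) and have equal compressions.
-- There the compression can be undone: an explicit "decompression" recovers
-- σ from σ_{i,j} (this uses i ≠ j and that σ is injective).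

open import Defs
open import Data.Nat using (ℕ)
open import Data.Fin using (Fin; _<_; zero; suc; _≟_)
open import Data.Fin.Properties using (<⇒≢)
open import Data.Vec using (Vec; lookup; tabulate; toList; _∷_)
open import Data.Vec.Properties using (lookup∘tabulate; tabulate∘lookup; tabulate-cong)
open import Data.List using (List; []; _∷_; map; filter; deduplicate; length)
open import Data.List.Properties using (length-map)
open import Data.List.Relation.Unary.All using (All)
import Data.List.Relation.Unary.All as All
open import Data.List.Relation.Unary.Any using (here; there)
open import Data.List.Relation.Unary.AllPairs using (_∷_)
open import Data.List.Relation.Unary.Unique.Propositional using (Unique)
open import Data.List.Membership.Propositional using (_∈_; _∉_)
open import Data.List.Membership.Propositional.Properties using (∈-deduplicate⁻)
open import Data.Vec.Membership.Propositional.Properties using (∈-lookup; ∈-toList⁺)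
import Data.List.Membership.DecPropositional as DecMembership
open import Data.Empty using (⊥-elim)
open import Data.Product using (_×_; _,_)
open import Data.Sum using (_⊎_; inj₁; inj₂)
open import Function using (_∘_)
open import Relation.Nullary using (yes; no; ¬_; ¬?)
open import Relation.Binary.Definitions using (DecidableEquality)
open import Relation.Binary.PropositionalEquality
  using (_≡_; _≢_; refl; sym; trans; cong; subst; ≢-sym; module ≡-Reasoning)

InjectiveTable : {n m : ℕ} → Vec (Fin n) m → Set
InjectiveTable σ = ∀ x y → lookup σ x ≡ lookup σ y → x ≡ y

perm-injective : {n m : ℕ} (σ : Vec (Fin n) m) → Unique (toList σ) → InjectiveTable σ
perm-injective (_ ∷ σ) (_ ∷ _)        zero    zero    _ = refl
perm-injective (_ ∷ σ) (x∉σ ∷ _)      zero    (suc b) e =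
  ⊥-elim (All.lookup x∉σ (∈-toList⁺ (∈-lookup b σ)) e)
perm-injective (_ ∷ σ) (x∉σ ∷ _)      (suc a) zero    e =
  ⊥-elim (All.lookup x∉σ (∈-toList⁺ (∈-lookup a σ)) (sym e))
perm-injective (_ ∷ σ) (_ ∷ distinct) (suc a) (suc b) e = cong suc (perm-injective σ distinct a b e)

table-ext : {n m : ℕ} (v w : Vec (Fin n) m) → (∀ y → lookup v y ≡ lookup w y) → v ≡ w
table-ext v w same = trans (sym (tabulate∘lookup v)) (trans (tabulate-cong same) (tabulate∘lookup w))

module _ {n : ℕ} (i j : Fin n) where

  Compressible : Vec (Fin n) n → Set
  Compressible σ = ¬ lookup σ i ≡ i × lookup σ j ≡ j

  compress-cases : ∀ σ → compress i j σ ≡ σ ⊎ Compressible σ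
  compress-cases σ with lookup σ i ≟ i | lookup σ j ≟ j
  ... | yes _    | _        = inj₁ refl
  ... | no _     | no _     = inj₁ refl
  ... | no σi≢i  | yes σj≡j = inj₂ (σi≢i , σj≡j)

  compressAt : Vec (Fin n) n → Fin n → Fin n
  compressAt σ y with y ≟ i | y ≟ j | lookup σ y ≟ i
  ... | yes _ | _     | _     = i
  ... | no _  | yes _ | _     = lookup σ i
  ... | no _  | no _  | yes _ = j
  ... | no _  | no _  | no _  = lookup σ y

  -- The function
  -- tabulated by compress is local to Defs and cannot be named, so the
  -- left-hand side of compressAt-unfolds is left to unification with its use
  -- in lookup-compress (checked first in this mutual block); it is then
  -- decided by the same case split as compressAt.
  mutual
    lookup-compress : ∀ σ → Compressible σ → ∀ y → lookup (compress i j σ) y ≡ compressAt σ y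
    lookup-compress σ (σi≢i , σj≡j) y with lookup σ i ≟ i | lookup σ j ≟ j
    ... | yes σi≡i | _        = ⊥-elim (σi≢i σi≡i)
    ... | no _     | no σj≢j  = ⊥-elim (σj≢j σj≡j)
    ... | no σi≢i′ | yes σj≡j′ =
      trans (lookup∘tabulate _ y) (compressAt-unfolds σ σi≢i′ σj≡j′ y)

    compressAt-unfolds : ∀ σ (σi≢i : ¬ lookup σ i ≡ i) (σj≡j : lookup σ j ≡ j) y → _ ≡ compressAt σ y
    compressAt-unfolds σ _ _ y with y ≟ i | y ≟ j | lookup σ y ≟ i
    ... | yes _ | _     | _     = refl
    ... | no _  | yes _ | _     = refl
    ... | no _  | no _  | yes _ = refl
    ... | no _  | no _  | no _  = refl

  compressAt-j : ∀ σ → j ≢ i → compressAt σ j ≡ lookup σ i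
  compressAt-j σ j≢i with j ≟ i | j ≟ j
  ... | yes j≡i | _       = ⊥-elim (j≢i j≡i)
  ... | no _    | yes _   = refl
  ... | no _    | no j≢j  = ⊥-elim (j≢j refl)

  compressAt-preimage : ∀ σ y → y ≢ i → y ≢ j → lookup σ y ≡ i → compressAt σ y ≡ j
  compressAt-preimage σ y y≢i y≢j σy≡i with y ≟ i | y ≟ j | lookup σ y ≟ i
  ... | yes y≡i | _       | _       = ⊥-elim (y≢i y≡i)
  ... | no _    | yes y≡j | _       = ⊥-elim (y≢j y≡j)
  ... | no _    | no _    | yes _   = refl
  ... | no _    | no _    | no σy≢i = ⊥-elim (σy≢i σy≡i)

  compressAt-other : ∀ σ y → y ≢ i → y ≢ j → lookup σ y ≢ i → compressAt σ y ≡ lookup σ y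
  compressAt-other σ y y≢i y≢j σy≢i with y ≟ i | y ≟ j | lookup σ y ≟ i
  ... | yes y≡i | _       | _       = ⊥-elim (y≢i y≡i)
  ... | no _    | yes y≡j | _       = ⊥-elim (y≢j y≡j)
  ... | no _    | no _    | yes σy≡i = ⊥-elim (σy≢i σy≡i)
  ... | no _    | no _    | no _    = refl

  decompressAt : Vec (Fin n) n → Fin n → Fin n
  decompressAt ρ y with y ≟ i | y ≟ j | lookup ρ y ≟ j
  ... | yes _ | _     | _     = lookup ρ j
  ... | no _  | yes _ | _     = j
  ... | no _  | no _  | yes _ = i
  ... | no _  | no _  | no _  = lookup ρ y

  decompress : Vec (Fin n) n → Vec (Fin n) n
  decompress ρ = tabulate (decompressAt ρ)

  decompress-compress : i ≢ j → ∀ σ → InjectiveTable σ → Compressible σ →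
                        decompress (compress i j σ) ≡ σ
  decompress-compress i≢j σ injective c@(_ , σj≡j) = table-ext _ σ pointwise
    where
    ρ = compress i j σ
    ρ≡ : ∀ y → lookup ρ y ≡ compressAt σ y
    ρ≡ = lookup-compress σ c
    pointwise : ∀ y → lookup (decompress ρ) y ≡ lookup σ y
    pointwise y rewrite lookup∘tabulate (decompressAt ρ) y with y ≟ i | y ≟ j | lookup ρ y ≟ j
    ... | yes refl | _        | _       = trans (ρ≡ j) (compressAt-j σ (≢-sym i≢j))
    ... | no _     | yes refl | _       = sym σj≡j
    ... | no y≢i   | no y≢j   | yes ρy≡j with lookup σ y ≟ i
    ...   | yes σy≡i = sym σy≡i
    ...   | no σy≢i  = ⊥-elim (y≢j (injective y j σy≡σj))
      where
      open ≡-Reasoning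
      σy≡σj : lookup σ y ≡ lookup σ j
      σy≡σj = begin
        lookup σ y      ≡⟨ sym (compressAt-other σ y y≢i y≢j σy≢i) ⟩
        compressAt σ y  ≡⟨ sym (ρ≡ y) ⟩
        lookup ρ y      ≡⟨ ρy≡j ⟩
        j               ≡⟨ sym σj≡j ⟩
        lookup σ j      ∎
    pointwise y | no y≢i | no y≢j | no ρy≢j with lookup σ y ≟ i
    ...   | yes σy≡i = ⊥-elim (ρy≢j (trans (ρ≡ y) (compressAt-preimage σ y y≢i y≢j σy≡i)))
    ...   | no σy≢i  = trans (ρ≡ y) (compressAt-other σ y y≢i y≢j σy≢i)

  compress-injective : i ≢ j → ∀ σ τ → InjectiveTable σ → InjectiveTable τ →
                       Compressible σ → Compressible τ → compress i j σ ≡ compress i j τ → σ ≡ τ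
  compress-injective i≢j σ τ injσ injτ cσ cτ same = begin
    σ                            ≡⟨ sym (decompress-compress i≢j σ injσ cσ) ⟩
    decompress (compress i j σ)  ≡⟨ cong decompress same ⟩
    decompress (compress i j τ)  ≡⟨ decompress-compress i≢j τ injτ cτ ⟩
    τ                            ∎
    where open ≡-Reasoning

InjectiveOn : {A B : Set} → (A → B) → List A → Set
InjectiveOn f xs = ∀ {x y} → x ∈ xs → y ∈ xs → f x ≡ f y → x ≡ y

module _ {A B : Set} (_≟A_ : DecidableEquality A) (_≟B_ : DecidableEquality B) (f : A → B) where

  filter-map : ∀ x ys → (∀ {y} → y ∈ ys → f y ≡ f x → y ≡ x) →
    filter (¬? ∘ (f x ≟B_)) (map f ys) ≡ map f (filter (¬? ∘ (x ≟A_)) ys)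
  filter-map x []       _      = refl
  filter-map x (y ∷ ys) unique with f x ≟B f y | x ≟A y
  ... | yes _      | yes _   = filter-map x ys (unique ∘ there)
  ... | yes fx≡fy  | no x≢y  = ⊥-elim (x≢y (sym (unique (here refl) (sym fx≡fy))))
  ... | no fx≢fy   | yes x≡y = ⊥-elim (fx≢fy (cong f x≡y))
  ... | no _       | no _    = cong (f y ∷_) (filter-map x ys (unique ∘ there))

  deduplicate-map : ∀ xs → InjectiveOn f xs →
    deduplicate _≟B_ (map f xs) ≡ map f (deduplicate _≟A_ xs)
  deduplicate-map []       _         = refl
  deduplicate-map (x ∷ xs) injective = begin
    f x ∷ filter (¬? ∘ (f x ≟B_)) (deduplicate _≟B_ (map f xs))
      ≡⟨ cong (λ zs → f x ∷ filter (¬? ∘ (f x ≟B_)) zs)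
              (deduplicate-map xs (λ x∈ y∈ → injective (there x∈) (there y∈))) ⟩
    f x ∷ filter (¬? ∘ (f x ≟B_)) (map f (deduplicate _≟A_ xs))
      ≡⟨ cong (f x ∷_) (filter-map x (deduplicate _≟A_ xs)
           (λ y∈ → injective (there (∈-deduplicate⁻ _≟A_ xs y∈)) (here refl))) ⟩
    f x ∷ map f (filter (¬? ∘ (x ≟A_)) (deduplicate _≟A_ xs))
      ∎
    where open ≡-Reasoning

card-map : {n : ℕ} (f : Vec (Fin n) n → Vec (Fin n) n) (xs : List (Vec (Fin n) n)) →
           InjectiveOn f xs → card (map f xs) ≡ card xs
card-map f xs injective =
  trans (cong length (deduplicate-map _≟ᵥ_ _≟ᵥ_ f xs injective)) (length-map f (deduplicate _≟ᵥ_ xs))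

module _ {n : ℕ} (i j : Fin n) (A : List (Vec (Fin n) n)) where

  compressIn-cases : ∀ σ → compressIn i j A σ ≡ σ ⊎ (compressIn i j A σ ≡ compress i j σ × compress i j σ ∉ A)
  compressIn-cases σ with DecMembership._∈?_ _≟ᵥ_ (compress i j σ) A
  ... | yes _ = inj₁ refl
  ... | no σ′∉A = inj₂ (refl , σ′∉A)

  leaves⇒compressible : ∀ {σ} → σ ∈ A → compress i j σ ∉ A → Compressible i j σ
  leaves⇒compressible {σ} σ∈A σ′∉A with compress-cases i j σ
  ... | inj₁ unchanged    = ⊥-elim (σ′∉A (subst (_∈ A) (sym unchanged) σ∈A))
  ... | inj₂ compressible = compressible

  compressIn-injective : i ≢ j → (∀ {σ} → σ ∈ A → InjectiveTable σ) → InjectiveOn (compressIn i j A) A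
  compressIn-injective i≢j injective {σ} {τ} σ∈A τ∈A same
    with compressIn-cases σ | compressIn-cases τ
  ... | inj₁ σ≡ | inj₁ τ≡ = trans (sym σ≡) (trans same τ≡)
  ... | inj₁ σ≡ | inj₂ (τ≡ , τ′∉A) = ⊥-elim (τ′∉A (subst (_∈ A) (trans (sym σ≡) (trans same τ≡)) σ∈A))
  ... | inj₂ (σ≡ , σ′∉A) | inj₁ τ≡ = ⊥-elim (σ′∉A (subst (_∈ A) (trans (sym τ≡) (trans (sym same) σ≡)) τ∈A))
  ... | inj₂ (σ≡ , σ′∉A) | inj₂ (τ≡ , τ′∉A) =
    compress-injective i j i≢j σ τ (injective σ∈A) (injective τ∈A)
      (leaves⇒compressible σ∈A σ′∉A) (leaves⇒compressible τ∈A τ′∉A)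
      (trans (sym σ≡) (trans same τ≡))

proposition2p3 : (n : ℕ) (A : List (Vec (Fin n) n)) → All IsPerm A →
    (i j : Fin n) → i < j → card (compressFamily i j A) ≡ card A
proposition2p3 n A perms i j i<j =
  card-map (compressIn i j A) A (compressIn-injective i j A (<⇒≢ i<j) permsInjective)
  where
  permsInjective : ∀ {σ} → σ ∈ A → InjectiveTable σ
  permsInjective {σ} σ∈A = perm-injective σ (All.lookup perms σ∈A)
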